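{- For every integer $n\ge0$, \[ 2p_n=\sum_{j=0}^na_{j,n}(q_{j-1}+q_{j-2})+\sum_{j=0}^{n-2}b_{j,n}(q_{j-1}+q_{j-2}). \]
   Context: The sequence $(q_n)_{n\ge -2}$ is defined by $q_{ -2}=q_{ -1}=1$, $q_n=2q_{n-1}+q_{n-2}$ for $n\ge0$. The sequence $(p_n)_{n\ge-2}$ is defined by $p_{ -2}=p_{ -1}=0$, $p_n=2p_{n-1}+p_{n-2}+\frac{q_{n-1}+q_{n-2}}{2}$ for $n\ge0$. The integers $a_{j,n}$ ($n\ge0$, $0\le j\le n$) and $b_{j,n}$ ($n\ge2$, $0\le j\le n-2$) are defined recursively by: $a_{n,n}=1$; $a_{j,n}=2a_{j,n-1}$ for $\max(0,n-3)\le j\le n-1$; $a_{j,n}=2a_{j,n-1}+b_{j,n-2}$ for $0\le j\le n-4$; $b_{n-2,n}=a_{n-2,n-2}$; $b_{j,n}=a_{j,n-2}+2b_{j,n-1}$ for $0\le j\le n-3$. (Empty sums are zero.) -}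

module Defs where

open import Data.Nat using (ℕ; zero; suc; _+_; _*_; _∸_; _/_; _≡ᵇ_; _<ᵇ_)
open import Data.Bool using (if_then_else_)

-- Shifted indexing: the paper's sequences start at index -2.
-- qs k = q_{k-2}, ps k = p_{k-2}  (so q_{-2} = qs 0, q_{-1} = qs 1, q_n = qs (n+2)).
qs : ℕ → ℕ
qs zero = 1
qs (suc zero) = 1
qs (suc (suc k)) = 2 * qs (suc k) + qs k

-- p_n = 2 p_{n-1} + p_{n-2} + (q_{n-1} + q_{n-2}) / 2 ; the numerator is always even
-- (all q_k are odd), so natural-number division by 2 is exact.
ps : ℕ → ℕ
ps zero = 0
ps (suc zero) = 0
ps (suc (suc k)) = 2 * ps (suc k) + ps k + (qs (suc k) + qs k) / 2

-- the paper's q_{j-1} + q_{j-2}, for j ≥ 0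
w : ℕ → ℕ
w j = qs (suc j) + qs j

-- a j n = a_{j,n} for 0 ≤ j ≤ n ; b j n = b_{j,n} for n ≥ 2, 0 ≤ j ≤ n-2.
-- Outside those index ranges the value is 0 (never used in the statement).
mutual
  a : ℕ → ℕ → ℕ
  a j zero = if j ≡ᵇ 0 then 1 else 0
  a j (suc zero) =
    if j ≡ᵇ 1 then 1 else (if 1 <ᵇ j then 0 else 2 * a j 0)
  a j (suc (suc m)) =
    if j ≡ᵇ suc (suc m) then 1
    else (if suc (suc m) <ᵇ j then 0
    -- max(0,n-3) ≤ j ≤ n-1  (n = m+2)
    else (if suc (suc m) <ᵇ j + 4 then 2 * a j (suc m)
    -- 0 ≤ j ≤ n-4
    else 2 * a j (suc m) + b j m))

  b : ℕ → ℕ → ℕ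
  b j zero = 0
  b j (suc zero) = 0
  b j (suc (suc m)) =
    if j ≡ᵇ m then a m m
    else (if m <ᵇ j then 0
    -- 0 ≤ j ≤ n-3  (n = m+2)
    else a j m + 2 * b j (suc m))

sumBelow : ℕ → (ℕ → ℕ) → ℕ
sumBelow zero f = 0
sumBelow (suc k) f = sumBelow k f + f k

module Submission where

-- Put c_{j,n} = a_{j,n} + b_{j,n} (b is zero outside its index
-- range), so the right-hand side of the theorem is
--   G n = Σ_{j ≤ n} c_{j,n} (q_{j-1} + q_{j-2}).
-- Unfolding the recursive definitions shows that, uniformly in j,
--   c_{j,n+2} = [j = n+2] + 2 c_{j,n+1} + c_{j,n},
-- so G obeys G (n+2) = w (n+2) + 2 G (n+1) + G n, where w j = q_{j-1} + q_{j-2}.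
-- Since every q_k is odd, the halving in the definition of p is exact and
-- 2 p_{n+2} = w (n+2) + 2 (2 p_{n+1}) + 2 p_n: the same recurrence.  Both sides
-- agree for n = 0, 1, and the theorem follows by two-step induction.

open import Defs
open import Data.Nat
  using (ℕ; zero; suc; _+_; _*_; _∸_; _/_; _≤_; _<_; _≤′_; ≤′-refl; ≤′-step; _≡ᵇ_; _<ᵇ_; z≤n; s≤s; s≤s⁻¹)
open import Data.Nat.Properties
open import Data.Nat.DivMod using (m*n/n≡m)
open import Data.Nat.Tactic.RingSolver using (solve-∀)
open import Data.Bool using (Bool; true; false; T; if_then_else_)
open import Data.Empty using (⊥-elim)
open import Data.Product using (∃; _×_; _,_; proj₁)
open import Function using (_∘_)
open import Relation.Nullary using (¬_)
open import Relation.Binary using (tri<; tri≈; tri>)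
open import Relation.Binary.PropositionalEquality
  using (_≡_; _≢_; refl; sym; trans; cong; cong₂; subst; module ≡-Reasoning)

open ≡-Reasoning

true-if-T : ∀ {b : Bool} → T b → b ≡ true
true-if-T {true} _ = refl

false-if-¬T : ∀ {b : Bool} → ¬ T b → b ≡ false
false-if-¬T {true} ¬t = ⊥-elim (¬t _)
false-if-¬T {false} _ = refl

≡ᵇ-refl : ∀ m → (m ≡ᵇ m) ≡ true
≡ᵇ-refl m = true-if-T (≡⇒≡ᵇ m m refl)

≡ᵇ-≢ : ∀ {m n} → m ≢ n → (m ≡ᵇ n) ≡ false
≡ᵇ-≢ {m} {n} m≢n = false-if-¬T (m≢n ∘ ≡ᵇ⇒≡ m n)

<ᵇ-< : ∀ {m n} → m < n → (m <ᵇ n) ≡ true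
<ᵇ-< = true-if-T ∘ <⇒<ᵇ

<ᵇ-≮ : ∀ {m n} → ¬ m < n → (m <ᵇ n) ≡ false
<ᵇ-≮ {m} {n} m≮n = false-if-¬T (m≮n ∘ <ᵇ⇒< m n)

a-vanishes : ∀ j n → n < j → a j n ≡ 0
a-vanishes (suc j) zero _ = refl
a-vanishes (suc zero) (suc zero) (s≤s ())
a-vanishes (suc (suc j)) (suc zero) _ = refl
a-vanishes j (suc (suc m)) n<j
  rewrite ≡ᵇ-≢ (>⇒≢ n<j) | <ᵇ-< n<j = refl

b-vanishes : ∀ j n → n ≤ suc j → b j n ≡ 0
b-vanishes j zero _ = refl
b-vanishes j (suc zero) _ = refl
b-vanishes j (suc (suc m)) n≤1+j
  rewrite ≡ᵇ-≢ (>⇒≢ (s≤s⁻¹ n≤1+j)) | <ᵇ-< (s≤s⁻¹ n≤1+j) = refl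

δ : ℕ → ℕ → ℕ
δ k j = if j ≡ᵇ k then 1 else 0

δ-off : ∀ {k j} → j ≢ k → δ k j ≡ 0
δ-off j≢k rewrite ≡ᵇ-≢ j≢k = refl

middle-range : ∀ j m → T (suc (suc m) <ᵇ j + 4) → m ≤ suc j
middle-range j m test =
  s≤s⁻¹ (s≤s⁻¹ (s≤s⁻¹ (subst (suc (suc (suc m)) ≤_) (+-comm j 4) (<ᵇ⇒< (suc (suc m)) (j + 4) test))))

-- The recurrence for a, valid for every j: the three cases of the definition
-- differ only by terms that vanish (the diagonal entry 1 appears as δ, and
-- b_{j,m} = 0 in the middle range max(0,n-3) ≤ j ≤ n-1).
a-rec : ∀ j m → a j (2 + m) ≡ δ (2 + m) j + 2 * a j (1 + m) + b j m
a-rec j m with <-cmp j (2 + m)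
... | tri≈ _ refl _
  rewrite ≡ᵇ-refl j | a-vanishes j (1 + m) ≤-refl | b-vanishes j m (m≤n+m m 3) = refl
... | tri> _ j≢n n<j
  rewrite ≡ᵇ-≢ j≢n | <ᵇ-< n<j
        | a-vanishes j (1 + m) (<-trans (n<1+n (1 + m)) n<j)
        | b-vanishes j m (≤-trans (m≤n+m m 3) (m≤n⇒m≤1+n n<j)) = refl
... | tri< j<n j≢n _ rewrite ≡ᵇ-≢ j≢n | <ᵇ-≮ (<⇒≯ j<n) with suc (suc m) <ᵇ j + 4 in near
...   | false = refl
...   | true rewrite b-vanishes j m (middle-range j m (subst T (sym near) _)) = sym (+-identityʳ _)

-- The recurrence for b, valid for every j (the diagonal b_{m,m+2} = a_{m,m}
-- is the general formula since b_{m,m+1} = 0).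
b-rec : ∀ j m → b j (2 + m) ≡ a j m + 2 * b j (1 + m)
b-rec j m with <-cmp j m
... | tri≈ _ refl _ rewrite ≡ᵇ-refl j | b-vanishes j (1 + j) ≤-refl = sym (+-identityʳ _)
... | tri> _ j≢m m<j
  rewrite ≡ᵇ-≢ j≢m | <ᵇ-< m<j | a-vanishes j m m<j | b-vanishes j (1 + m) (s≤s (<⇒≤ m<j)) = refl
... | tri< j<m j≢m _ rewrite ≡ᵇ-≢ j≢m | <ᵇ-≮ (<⇒≯ j<m) = refl

c : ℕ → ℕ → ℕ
c j n = a j n + b j n

c-vanishes : ∀ j n → n < j → c j n ≡ 0
c-vanishes j n n<j rewrite a-vanishes j n n<j | b-vanishes j n (<⇒≤ (<-trans n<j (n<1+n j))) = refl

c-rec : ∀ j m → c j (2 + m) ≡ δ (2 + m) j + 2 * c j (1 + m) + c j m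
c-rec j m rewrite a-rec j m | b-rec j m =
  regroup (δ (2 + m) j) (a j (1 + m)) (b j (1 + m)) (a j m) (b j m)
  where
  regroup : ∀ d a₁ b₁ a₀ b₀ → d + 2 * a₁ + b₀ + (a₀ + 2 * b₁) ≡ d + 2 * (a₁ + b₁) + (a₀ + b₀)
  regroup = solve-∀

sumBelow-cong : ∀ k {f g : ℕ → ℕ} → (∀ j → f j ≡ g j) → sumBelow k f ≡ sumBelow k g
sumBelow-cong zero _ = refl
sumBelow-cong (suc k) f≗g = cong₂ _+_ (sumBelow-cong k f≗g) (f≗g k)

sumBelow-+ : ∀ k (f g : ℕ → ℕ) → sumBelow k (λ j → f j + g j) ≡ sumBelow k f + sumBelow k g
sumBelow-+ zero f g = refl
sumBelow-+ (suc k) f g rewrite sumBelow-+ k f g = interchange (sumBelow k f) (sumBelow k g) (f k) (g k)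
  where
  interchange : ∀ x y u v → x + y + (u + v) ≡ x + u + (y + v)
  interchange = solve-∀

sumBelow-* : ∀ k r (f : ℕ → ℕ) → sumBelow k (λ j → r * f j) ≡ r * sumBelow k f
sumBelow-* zero r f = sym (*-zeroʳ r)
sumBelow-* (suc k) r f rewrite sumBelow-* k r f = sym (*-distribˡ-+ r (sumBelow k f) (f k))

sumBelow-pad : ∀ {k K} (f : ℕ → ℕ) → k ≤′ K → (∀ j → k ≤ j → f j ≡ 0) → sumBelow K f ≡ sumBelow k f
sumBelow-pad f ≤′-refl _ = refl
sumBelow-pad {k} {suc K} f (≤′-step k≤′K) zero-from-k =
  begin
    sumBelow K f + f K ≡⟨ cong₂ _+_ (sumBelow-pad f k≤′K zero-from-k) (zero-from-k K (≤′⇒≤ k≤′K)) ⟩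
    sumBelow k f + 0   ≡⟨ +-identityʳ _ ⟩
    sumBelow k f       ∎

sumBelow-zero : ∀ k (f : ℕ → ℕ) → (∀ j → j < k → f j ≡ 0) → sumBelow k f ≡ 0
sumBelow-zero zero f _ = refl
sumBelow-zero (suc k) f zero-below
  rewrite sumBelow-zero k f (λ j j<k → zero-below j (<-trans j<k (n<1+n k))) | zero-below k ≤-refl = refl

sumBelow-δ : ∀ k (f : ℕ → ℕ) → sumBelow (suc k) (λ j → δ k j * f j) ≡ f k
sumBelow-δ k f
  rewrite sumBelow-zero k (λ j → δ k j * f j) (λ j j<k → cong (_* f j) (δ-off (<⇒≢ j<k)))
        | ≡ᵇ-refl k = +-identityʳ (f k)

G : ℕ → ℕ
G n = sumBelow (suc n) (λ j → c j n * w j)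

G-pad : ∀ n K → suc n ≤ K → sumBelow K (λ j → c j n * w j) ≡ G n
G-pad n K n<K = sumBelow-pad _ (≤⇒≤′ n<K) (λ j n<j → cong (_* w j) (c-vanishes j n n<j))

-- Multiplying the recurrence for c by w j and summing over j ≤ n + 2.
G-rec : ∀ m → G (2 + m) ≡ w (2 + m) + 2 * G (1 + m) + G m
G-rec m =
  begin
    G (2 + m)
      ≡⟨ sumBelow-cong (3 + m) (λ j → trans (cong (_* w j) (c-rec j m)) (expand j)) ⟩
    sumBelow (3 + m) (λ j → δ (2 + m) j * w j + 2 * (c j (1 + m) * w j) + c j m * w j)
      ≡⟨ trans (sumBelow-+ (3 + m) _ (λ j → c j m * w j))
               (cong (_+ sumBelow (3 + m) (λ j → c j m * w j)) (sumBelow-+ (3 + m) _ _)) ⟩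
    sumBelow (3 + m) (λ j → δ (2 + m) j * w j)
      + sumBelow (3 + m) (λ j → 2 * (c j (1 + m) * w j))
      + sumBelow (3 + m) (λ j → c j m * w j)
      ≡⟨ cong₂ _+_ (cong₂ _+_ (sumBelow-δ (2 + m) w)
                              (trans (sumBelow-* (3 + m) 2 _) (cong (2 *_) (G-pad (1 + m) (3 + m) (n≤1+n (2 + m))))))
                   (G-pad m (3 + m) (m≤n+m (1 + m) 2)) ⟩
    w (2 + m) + 2 * G (1 + m) + G m
  ∎
  where
  expand : ∀ j → (δ (2 + m) j + 2 * c j (1 + m) + c j m) * w j
               ≡ δ (2 + m) j * w j + 2 * (c j (1 + m) * w j) + c j m * w j
  expand j = distrib (δ (2 + m) j) (c j (1 + m)) (c j m) (w j)
    where
    distrib : ∀ d x y z → (d + 2 * x + y) * z ≡ d * z + 2 * (x * z) + y * z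
    distrib = solve-∀

-- Every q_k is odd (q_{-2} = q_{-1} = 1 and q_k ≡ q_{k-2} mod 2) ...
qs-odd : ∀ k → ∃ λ t → qs k ≡ 1 + 2 * t
qs-odd zero = 0 , refl
qs-odd (suc zero) = 0 , refl
qs-odd (suc (suc k)) with qs-odd k
... | t , qₖ≡ = qs (suc k) + t , trans (cong (2 * qs (suc k) +_) qₖ≡) (odd-step (qs (suc k)) t)
  where
  odd-step : ∀ q t → 2 * q + (1 + 2 * t) ≡ 1 + 2 * (q + t)
  odd-step = solve-∀

-- ... hence w k = q_{k-1} + q_{k-2} is even and halving it is exact.
w-halve : ∀ k → 2 * (w k / 2) ≡ w k
w-halve k with qs-odd (suc k) | qs-odd k
... | s , q₁≡ | t , q₀≡ =
  begin
    2 * (w k / 2)                ≡⟨ cong (λ x → 2 * (x / 2)) w≡ ⟩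
    2 * ((1 + s + t) * 2 / 2)    ≡⟨ cong (2 *_) (m*n/n≡m (1 + s + t) 2) ⟩
    2 * (1 + s + t)              ≡⟨ sym (trans w≡ (*-comm (1 + s + t) 2)) ⟩
    w k                          ∎
  where
  sum-of-odds : ∀ s t → 1 + 2 * s + (1 + 2 * t) ≡ (1 + s + t) * 2
  sum-of-odds = solve-∀
  w≡ : w k ≡ (1 + s + t) * 2
  w≡ = trans (cong₂ _+_ q₁≡ q₀≡) (sum-of-odds s t)

ps-rec : ∀ m → 2 * ps (4 + m) ≡ w (2 + m) + 2 * (2 * ps (3 + m)) + 2 * ps (2 + m)
ps-rec m =
  begin
    2 * (2 * ps (3 + m) + ps (2 + m) + w (2 + m) / 2)
      ≡⟨ double (ps (3 + m)) (ps (2 + m)) (w (2 + m) / 2) ⟩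
    2 * (w (2 + m) / 2) + 2 * (2 * ps (3 + m)) + 2 * ps (2 + m)
      ≡⟨ cong (λ x → x + 2 * (2 * ps (3 + m)) + 2 * ps (2 + m)) (w-halve (2 + m)) ⟩
    w (2 + m) + 2 * (2 * ps (3 + m)) + 2 * ps (2 + m)
  ∎
  where
  double : ∀ x y h → 2 * (2 * x + y + h) ≡ 2 * h + 2 * (2 * x) + 2 * y
  double = solve-∀

-- 2 p_n and G n satisfy the same second-order recurrence and agree at
-- n = 0, 1; two-step induction, carried as a pair of consecutive values.
2ps≡G : ∀ n → 2 * ps (2 + n) ≡ G n × 2 * ps (3 + n) ≡ G (1 + n)
2ps≡G zero = refl , refl
2ps≡G (suc n) with 2ps≡G n
... | eₙ , eₙ₊₁ = eₙ₊₁ ,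
  (begin
    2 * ps (4 + n)                                   ≡⟨ ps-rec n ⟩
    w (2 + n) + 2 * (2 * ps (3 + n)) + 2 * ps (2 + n) ≡⟨ cong₂ (λ x y → w (2 + n) + 2 * x + y) eₙ₊₁ eₙ ⟩
    w (2 + n) + 2 * G (1 + n) + G n                   ≡⟨ sym (G-rec n) ⟩
    G (2 + n)                                         ∎)

b-sum-pad : ∀ n → sumBelow (suc n) (λ j → b j n * w j) ≡ sumBelow (n ∸ 1) (λ j → b j n * w j)
b-sum-pad n = sumBelow-pad _ (≤⇒≤′ (≤-trans (m∸n≤m n 1) (n≤1+n n)))
  (λ j n-1≤j → cong (_* w j) (b-vanishes j n (≤-trans (n≤1+n∸1 n) (s≤s n-1≤j))))
  where
  n≤1+n∸1 : ∀ n → n ≤ suc (n ∸ 1)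
  n≤1+n∸1 zero = z≤n
  n≤1+n∸1 (suc n) = ≤-refl

lemma4 : (n : ℕ) →
    2 * ps (n + 2) ≡
      sumBelow (suc n) (λ j → a j n * w j) + sumBelow (n ∸ 1) (λ j → b j n * w j)
lemma4 n =
  begin
    2 * ps (n + 2)   ≡⟨ cong (λ k → 2 * ps k) (+-comm n 2) ⟩
    2 * ps (2 + n)   ≡⟨ proj₁ (2ps≡G n) ⟩
    G n              ≡⟨ sumBelow-cong (suc n) (λ j → *-distribʳ-+ (w j) (a j n) (b j n)) ⟩
    sumBelow (suc n) (λ j → a j n * w j + b j n * w j)
                     ≡⟨ sumBelow-+ (suc n) _ _ ⟩
    sumBelow (suc n) (λ j → a j n * w j) + sumBelow (suc n) (λ j → b j n * w j)
                     ≡⟨ cong (sumBelow (suc n) (λ j → a j n * w j) +_) (b-sum-pad n) ⟩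
    sumBelow (suc n) (λ j → a j n * w j) + sumBelow (n ∸ 1) (λ j → b j n * w j)
  ∎
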